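{- Let $\Omega_1=\{0,1\}^{\mathbb N\times\mathbb N}$ with evaluation set $\Lambda_{\mathrm{mat}}=\{A\mapsto A(i,j):(i,j)\in\mathbb N^2\}$, and for $m\ge1$ let $\Xi_m:\Omega_1\to\{0,1\}$ be as defined below. Then for every $m\ge1$, $\Xi_m\notin\Delta^G_{m-1}$, i.e. $\mathrm{SCI}_G(\Xi_m,\Omega_1,\{0,1\},\Lambda_{\mathrm{mat}})\ge m$; moreover $\mathrm{SCI}_G(\Xi_m,\Omega_1,\{0,1\},\Lambda_{\mathrm{mat}})=m$.
   Context: For each $m\ge1$ fix a bijection $\beta_m:\mathbb N^m\to\mathbb N\times\mathbb N$, $\beta_m(n_1,\dots,n_m)=(i(n_1,\dots,n_m),j(n_1,\dots,n_m))$, and set $P_m(A;n_1,\dots,n_m)=a_{i(n_1,\dots,n_m),j(n_1,\dots,n_m)}$ for $A=(a_{i,j})\in\Omega_1$. Let $Q_1=\exists,Q_2=\forall,Q_3=\exists,\dots$ alternate. Then $\Xi_m(A)=1$ iff $(Q_1n_1)(Q_2n_2)\cdots(Q_mn_m)[P_m(A;n_1,\dots,n_m)=1]$. $\{0,1\}$ carries the discrete metric. A general algorithm is a map $\Gamma:\Omega_1\to\{0,1\}$ such that for each $A$ there is a finite nonempty $\Lambda_\Gamma(A)\subset\Lambda_{\mathrm{mat}}$ with $\Gamma(A)$ depending only on $\{f(A):f\in\Lambda_\Gamma(A)\}$, and with $\Lambda_\Gamma(B)=\Lambda_\Gamma(A)$ whenever $f(B)=f(A)$ for all $f\in\Lambda_\Gamma(A)$.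 A tower of height $k$ is a family of general algorithms $\Gamma_{n_k,\dots,n_1}$ whose iterated pointwise limits $\lim_{n_k}\cdots\lim_{n_1}$ exist at every stage and equal $\Xi$. $\mathrm{SCI}_G$ is the minimal such height ($0$ if $\Xi$ is a general algorithm); $\Delta^G_k$ is the class of problems with $\mathrm{SCI}_G\le k$. -}

module Defs where

open import Level using (0ℓ)
open import Data.Bool using (Bool; true; false)
open import Data.Nat using (ℕ; _≤_; _<_)
open import Data.Product using (Σ; ∃; _×_; _,_; proj₁; proj₂)
open import Data.Vec using (Vec; []; _∷_)
open import Data.List using (List; _∷_)
open import Data.List.Membership.Propositional using (_∈_)
open import Relation.Binary.PropositionalEquality using (_≡_)
open import Function.Bundles using (_⤖_; _⇔_; Bijection)

-- Ω₁ = {0,1}^(ℕ×ℕ): infinite 0/1 matrices (false = 0, true = 1)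
Ω₁ : Set
Ω₁ = ℕ → ℕ → Bool

-- An evaluation function in Λ_mat is A ↦ A(i,j); we index it by (i , j).
Index : Set
Index = ℕ × ℕ

eval : Index → Ω₁ → Bool
eval (i , j) A = A i j

QF : (k : ℕ) → Bool → (Vec ℕ k → Set) → Set
QF ℕ.zero    _     P = P []
QF (ℕ.suc k) true  P = Σ ℕ λ n → QF k false (λ v → P (n ∷ v))
QF (ℕ.suc k) false P = (n : ℕ) → QF k true (λ v → P (n ∷ v))

XiHolds : (m : ℕ) → (Vec ℕ m ⤖ Index) → Ω₁ → Set
XiHolds m β A = QF m true (λ v → eval (Bijection.to β v) A ≡ true)

XiValue : (m : ℕ) → (Vec ℕ m ⤖ Index) → Ω₁ → Bool → Set
XiValue m β A b = (b ≡ true) ⇔ XiHolds m β A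

record GeneralAlgorithm : Set where
  field
    Γ       : Ω₁ → Bool
    Λ       : Ω₁ → List Index
    nonempty : ∀ A → Σ Index λ f → f ∈ Λ A
    consistent : ∀ A B → (∀ f → f ∈ Λ A → eval f B ≡ eval f A) →
                 (Γ B ≡ Γ A) × (∀ f → (f ∈ Λ B) ⇔ (f ∈ Λ A))

Lim : (ℕ → Bool) → Bool → Set
Lim s b = Σ ℕ λ N → ∀ n → N ≤ n → s n ≡ b

-- The index vector is (n₁ ∷ n₂ ∷ … ∷ n_k ∷ []); the innermost
-- limit is taken over n₁, producing a function h of (n₂,…,n_k), etc.
IterLim : (k : ℕ) → (Vec ℕ k → Bool) → Bool → Set
IterLim ℕ.zero    g b = g [] ≡ b
IterLim (ℕ.suc k) g b =
  Σ (Vec ℕ k → Bool) λ h → ((v : Vec ℕ k) → Lim (λ n → g (n ∷ v)) (h v)) × IterLim k h b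

record Tower (k m : ℕ) (β : Vec ℕ m ⤖ Index) : Set where
  field
    alg : Vec ℕ k → GeneralAlgorithm
    converges : ∀ A → Σ Bool λ b →
      IterLim k (λ v → GeneralAlgorithm.Γ (alg v) A) b × XiValue m β A b

InDelta : (k m : ℕ) → (Vec ℕ m ⤖ Index) → Set
InDelta k m β = Σ ℕ λ k' → k' ≤ k × Tower k' m β

{-# OPTIONS --safe #-}
-- Upper bound: Ξ_m(A) is the iterated limit of the truth values of the same formula with its
-- quantifiers bounded, the innermost limit removing the bound on the innermost quantifier; a
-- formula with bounded quantifiers reads only finitely many entries of A.
--
-- Lower bound: a general algorithm reads finitely many entries, so "Γ(A) = c" says both that Γ is
-- constantly c near A and that it takes the value c arbitrarily near A.  Unfolding each limit as
-- "eventually" or "infinitely often" and merging like quantifiers with a pairing function, the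
-- output of a tower of height k < m is 0 at A iff an alternating formula in m variables, starting
-- with ∃, holds, whose matrix at u reads only entries of rank < Σu, where rank f = Σ β⁻¹(f).
-- Defining A(β u) by recursion on rank as the truth value of that matrix gives a matrix on which
-- the tower outputs 0 exactly when Ξ_m(A) = 1.
module Submission where

open import Defs
open import Level using (0ℓ)
open import Axiom.ExcludedMiddle using (ExcludedMiddle)
open import Axiom.DoubleNegationElimination using (em⇒dne)
open import Data.Bool using (Bool; true; false; not)
open import Data.Nat using (ℕ; zero; suc; _+_; _∸_; _⊔_; _≤_; _<_; _≤′_; ≤′-reflexive; ≤′-step; z≤n; s≤s)
open import Data.Nat.Properties
open import Data.Product using (∃; ∃-syntax; _×_; _,_; proj₁; proj₂; uncurry)
open import Data.Vec using (Vec; []; _∷_; _∷ʳ_; sum; drop)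
open import Data.Vec.Relation.Unary.All as All using (All; []; _∷_)
open import Data.List using (List; []; _∷_; [_]; map; upTo; cartesianProductWith)
open import Data.List.Extrema.Nat using (max; xs≤max)
open import Data.List.Membership.Propositional using (_∈_)
open import Data.List.Membership.Propositional.Properties using (∈-map⁺; ∈-upTo⁺; ∈-cartesianProductWith⁺)
import Data.List.Relation.Unary.All as ListAll
open import Data.List.Relation.Unary.All.Properties using (map⁻)
open import Data.List.Relation.Unary.Any using (here; there)
open import Function using (_∘_)
open import Function.Bundles using (_⤖_; _⇔_; mk⇔; Equivalence; Inverse)
open import Function.Properties.Bijection using (⤖⇒↔)
import Function.Properties.Equivalence as ⇔
open import Relation.Nullary using (¬_; yes; no; does; contradiction)
open import Relation.Nullary.Decidable using (does-⇔)
open import Relation.Binary.PropositionalEquality using (_≡_; refl; sym; trans; cong; subst)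
import Relation.Binary.Reasoning.Setoid as SetoidReasoning

open Equivalence using (to; from)

module ⇔-Reasoning = SetoidReasoning (⇔.⇔-setoid 0ℓ)

∃-cong-⇔ : {A : Set} {P Q : A → Set} → (∀ x → P x ⇔ Q x) → ∃ P ⇔ ∃ Q
∃-cong-⇔ e = mk⇔ (λ (x , p) → x , to (e x) p) (λ (x , q) → x , from (e x) q)

Π-cong-⇔ : {A : Set} {P Q : A → Set} → (∀ x → P x ⇔ Q x) → (∀ x → P x) ⇔ (∀ x → Q x)
Π-cong-⇔ e = mk⇔ (λ f x → to (e x) (f x)) (λ g x → from (e x) (g x))

subst-⇔ : {A : Set} (P : A → Set) {x y : A} → x ≡ y → P x ⇔ P y
subst-⇔ P refl = ⇔.refl

¬[b≡true⇔b≡false] : {b : Bool} → ¬ ((b ≡ true) ⇔ (b ≡ false))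
¬[b≡true⇔b≡false] {true}  e with () ← to e refl
¬[b≡true⇔b≡false] {false} e with () ← from e refl

-- Alternating quantifier prefixes

alternate : ℕ → Bool → Bool
alternate zero    q = q
alternate (suc d) q = alternate d (not q)

QF-cong : ∀ {n q} {P P′ : Vec ℕ n → Set} → (∀ v → P v ⇔ P′ v) → QF n q P ⇔ QF n q P′
QF-cong {zero}          e = e []
QF-cong {suc n} {true}  e = ∃-cong-⇔ λ x → QF-cong (e ∘ (x ∷_))
QF-cong {suc n} {false} e = Π-cong-⇔ λ x → QF-cong (e ∘ (x ∷_))

QF-drop : ∀ d {n} q (P : Vec ℕ n → Set) → QF (d + n) q (P ∘ drop d) ⇔ QF n (alternate d q) P
QF-drop zero    q     P = ⇔.refl
QF-drop (suc d) true  P = mk⇔ (λ (_ , p) → to (QF-drop d false P) p) (λ p → 0 , from (QF-drop d false P) p)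
QF-drop (suc d) false P = mk⇔ (λ p → to (QF-drop d true P) (p 0))    (λ p _ → from (QF-drop d true P) p)

sum-drop-≤ : ∀ d {n} (u : Vec ℕ (d + n)) → sum (drop d u) ≤ sum u
sum-drop-≤ zero    u       = ≤-refl
sum-drop-≤ (suc d) (x ∷ u) = ≤-trans (sum-drop-≤ d u) (m≤n+m _ x)

Quant : Bool → (ℕ → Set) → Set
Quant true  P = ∃ P
Quant false P = ∀ z → P z

Bounded : Bool → ℕ → (ℕ → Set) → Set
Bounded true  a P = ∃[ z ] z ≤ a × P z
Bounded false a P = ∀ z → z ≤ a → P z

Bounded-cong : ∀ q {a} {P Q : ℕ → Set} → (∀ z → z ≤ a → P z ⇔ Q z) → Bounded q a P ⇔ Bounded q a Q
Bounded-cong true  e = mk⇔ (λ (z , z≤a , p) → z , z≤a , to (e z z≤a) p)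
                           (λ (z , z≤a , q) → z , z≤a , from (e z z≤a) q)
Bounded-cong false e = mk⇔ (λ h z z≤a → to (e z z≤a) (h z z≤a))
                           (λ h z z≤a → from (e z z≤a) (h z z≤a))

QF-∷ʳ : ∀ r q (P : Vec ℕ (suc r) → Set) →
        QF (suc r) q P ⇔ QF r q (λ x → Quant (alternate r q) (λ z → P (x ∷ʳ z)))
QF-∷ʳ zero    true  P = ⇔.refl
QF-∷ʳ zero    false P = ⇔.refl
QF-∷ʳ (suc r) true  P = ∃-cong-⇔ λ x → QF-∷ʳ r false (P ∘ (x ∷_))
QF-∷ʳ (suc r) false P = Π-cong-⇔ λ x → QF-∷ʳ r true (P ∘ (x ∷_))

-- The bounds are listed innermost first: the head of the bound vector bounds the last variable,
-- so that the innermost limit of IterLim removes the innermost bound.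
boundedPrefix : ∀ r → Bool → (Vec ℕ r → Set) → Vec ℕ r → Set
boundedPrefix zero    q P []      = P []
boundedPrefix (suc r) q P (a ∷ v) =
  boundedPrefix r q (λ x → Bounded (alternate r q) a (λ z → P (x ∷ʳ z))) v

∷ʳ⁺ : ∀ {r} {P : ℕ → Set} {x : Vec ℕ r} {z} → All P x → P z → All P (x ∷ʳ z)
∷ʳ⁺ []         pz = pz ∷ []
∷ʳ⁺ (py ∷ pys) pz = py ∷ ∷ʳ⁺ pys pz

boundedPrefix-cong : ∀ {r q M} {P P′ : Vec ℕ r → Set} {v} → All (_≤ M) v →
                     (∀ x → All (_≤ M) x → P x ⇔ P′ x) → boundedPrefix r q P v ⇔ boundedPrefix r q P′ v
boundedPrefix-cong {zero}        []           e = e [] []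
boundedPrefix-cong {suc r} {q} (a≤M ∷ v≤M) e = boundedPrefix-cong v≤M λ x x≤M →
  Bounded-cong (alternate r q) λ z z≤a → e (x ∷ʳ z) (∷ʳ⁺ x≤M (≤-trans z≤a a≤M))

boundedVecs : ∀ r → ℕ → List (Vec ℕ r)
boundedVecs zero    M = [ [] ]
boundedVecs (suc r) M = cartesianProductWith _∷_ (upTo (suc M)) (boundedVecs r M)

∈-boundedVecs : ∀ {r M} {x : Vec ℕ r} → All (_≤ M) x → x ∈ boundedVecs r M
∈-boundedVecs []           = here refl
∈-boundedVecs (y≤M ∷ x≤M) = ∈-cartesianProductWith⁺ _∷_ (∈-upTo⁺ (s≤s y≤M)) (∈-boundedVecs x≤M)

xs≤sum : ∀ {r} (v : Vec ℕ r) → All (_≤ sum v) v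
xs≤sum []      = []
xs≤sum (x ∷ v) = m≤m+n x (sum v) ∷ All.map (λ y≤ → ≤-trans y≤ (m≤n+m (sum v) x)) (xs≤sum v)

-- Eventually true properties and limits

Eventually : (ℕ → Set) → Set
Eventually P = ∃[ N ] ∀ n → N ≤ n → P n

eventually-map : {P Q : ℕ → Set} → (∀ n → P n → Q n) → Eventually P → Eventually Q
eventually-map f (N , p) = N , λ n N≤n → f n (p n N≤n)

eventually-× : {P Q : ℕ → Set} → Eventually P → Eventually Q → Eventually (λ n → P n × Q n)
eventually-× (N , p) (M , q) = N ⊔ M , λ n N⊔M≤n → p n (m⊔n≤o⇒m≤o N M N⊔M≤n) , q n (m⊔n≤o⇒n≤o N M N⊔M≤n)

eventually-∀∈ : {A : Set} {P : A → ℕ → Set} (xs : List A) →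
                (∀ x → x ∈ xs → Eventually (P x)) → Eventually (λ n → ∀ x → x ∈ xs → P x n)
eventually-∀∈ []       _  = 0 , λ _ _ _ ()
eventually-∀∈ {P = P} (x ∷ xs) ev =
  eventually-map both (eventually-× (ev x (here refl)) (eventually-∀∈ xs (λ y → ev y ∘ there)))
  where
  both : ∀ n → P x n × (∀ y → y ∈ xs → P y n) → ∀ y → y ∈ x ∷ xs → P y n
  both n (px , pxs) y (here refl) = px
  both n (px , pxs) y (there y∈) = pxs y y∈

Converges : (ℕ → Set) → Set → Set
Converges P P∞ = Eventually (λ n → P n ⇔ P∞)

boundedPrefix-converges : ∀ {r q} {P : ℕ → Vec ℕ r → Set} {P∞ : Vec ℕ r → Set} →
  (∀ x → Converges (λ n → P n x) (P∞ x)) →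
  ∀ v → Converges (λ n → boundedPrefix r q (P n) v) (boundedPrefix r q P∞ v)
boundedPrefix-converges {r} conv v =
  eventually-map (λ n agree → boundedPrefix-cong (xs≤sum v) (λ x x≤ → agree x (∈-boundedVecs x≤)))
                 (eventually-∀∈ (boundedVecs r (sum v)) (λ x _ → conv x))

Lim⇒≡⇔eventually : ∀ {s b c} → Lim s b → (b ≡ c) ⇔ (∃[ N ] ∀ M → s (M + N) ≡ c)
Lim⇒≡⇔eventually (N₀ , conv) = mk⇔
  (λ b≡c → N₀ , λ M → trans (conv (M + N₀) (m≤n+m N₀ M)) b≡c)
  (λ (N , ev) → trans (sym (conv (N₀ + N) (m≤m+n N₀ N))) (ev N₀))

Lim⇒≡⇔frequently : ∀ {s b c} → Lim s b → (b ≡ c) ⇔ (∀ N → ∃[ M ] s (M + N) ≡ c)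
Lim⇒≡⇔frequently (N₀ , conv) = mk⇔
  (λ b≡c N → N₀ , trans (conv (N₀ + N) (m≤m+n N₀ N)) b≡c)
  (λ fr → let (M , e) = fr N₀ in trans (sym (conv (M + N₀) (m≤n+m N₀ M))) e)

-- Iterated limits as alternating formulas

next : ℕ × ℕ → ℕ × ℕ
next (zero  , b) = suc b , 0
next (suc a , b) = a , suc b

unpair : ℕ → ℕ × ℕ
unpair zero    = 0 , 0
unpair (suc p) = next (unpair p)

proj₂-unpair-≤ : ∀ p → proj₂ (unpair p) ≤ p
proj₂-unpair-≤ zero    = z≤n
proj₂-unpair-≤ (suc p) = ≤-trans (proj₂-next (unpair p)) (s≤s (proj₂-unpair-≤ p))
  where
  proj₂-next : ∀ x → proj₂ (next x) ≤ suc (proj₂ x)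
  proj₂-next (zero  , b) = z≤n
  proj₂-next (suc a , b) = ≤-refl

unpair-surjective : ∀ a b → ∃[ p ] unpair p ≡ (a , b)
unpair-surjective a b = onDiagonal (a + b) a b refl
  where
  onDiagonal : ∀ s a b → a + b ≡ s → ∃[ p ] unpair p ≡ (a , b)
  onDiagonal _       zero    zero    _  = 0 , refl
  onDiagonal zero    (suc a) zero    ()
  onDiagonal (suc s) (suc a) zero    eq
    with p , e ← onDiagonal s zero a (trans (sym (+-identityʳ a)) (suc-injective eq)) = suc p , cong next e
  onDiagonal s       a       (suc b) eq
    with p , e ← onDiagonal s (suc a) b (trans (sym (+-suc a b)) eq) = suc p , cong next e

Π-unpair : {P : ℕ → ℕ → Set} → (∀ a b → P a b) ⇔ (∀ p → uncurry P (unpair p))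
Π-unpair {P} = mk⇔
  (λ f p → f (proj₁ (unpair p)) (proj₂ (unpair p)))
  (λ f a b → let (p , e) = unpair-surjective a b in subst (uncurry P) e (f p))

Σ-unpair : {P : ℕ → ℕ → Set} → (∃[ a ] ∃[ b ] P a b) ⇔ (∃[ p ] uncurry P (unpair p))
Σ-unpair {P} = mk⇔
  (λ (a , b , x) → let (p , e) = unpair-surjective a b in p , subst (uncurry P) (sym e) x)
  (λ (p , x) → proj₁ (unpair p) , proj₂ (unpair p) , x)

-- Formula k n q w: a matrix in n variables under a prefix with leading quantifier q (true = ∃),
-- depending on the indices w of the k limits still to be taken.
Formula : ℕ → ℕ → Set₁
Formula k n = Bool → Vec ℕ k → Vec ℕ n → Set

Defines : ∀ {k n} → (Vec ℕ k → Bool) → Bool → Formula k n → Set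
Defines g c S = ∀ q w → (g w ≡ c) ⇔ QF _ q (S q w)

-- N is the threshold of the innermost limit; p codes both the offset M beyond N and the leading
-- variable of S, which is quantified like M.
limitStep : ∀ {k j} → Formula (suc k) (suc j) → Formula k (suc (suc j))
limitStep S q w (N ∷ p ∷ y) = S (not q) (proj₁ (unpair p) + N ∷ w) (proj₂ (unpair p) ∷ y)

limitStep-defines : ∀ {k j} {g : Vec ℕ (suc k) → Bool} {h : Vec ℕ k → Bool} {c}
                    {S : Formula (suc k) (suc j)} →
  (∀ w → Lim (λ n → g (n ∷ w)) (h w)) → Defines g c S → Defines h c (limitStep S)
limitStep-defines {j = j} {g} {h} {c} {S} lim g-def true w = begin
  h w ≡ c
    ≈⟨ Lim⇒≡⇔eventually (lim w) ⟩
  (∃[ N ] ∀ M → g (M + N ∷ w) ≡ c)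
    ≈⟨ ∃-cong-⇔ (λ N → Π-cong-⇔ λ M → g-def false (M + N ∷ w)) ⟩
  (∃[ N ] ∀ M → QF (suc j) false (S false (M + N ∷ w)))
    ≈⟨ ∃-cong-⇔ (λ N → Π-unpair) ⟩
  QF (suc (suc j)) true (limitStep S true w)
    ∎
  where open ⇔-Reasoning
limitStep-defines {j = j} {g} {h} {c} {S} lim g-def false w = begin
  h w ≡ c
    ≈⟨ Lim⇒≡⇔frequently (lim w) ⟩
  (∀ N → ∃[ M ] g (M + N ∷ w) ≡ c)
    ≈⟨ Π-cong-⇔ (λ N → ∃-cong-⇔ λ M → g-def true (M + N ∷ w)) ⟩
  (∀ N → ∃[ M ] QF (suc j) true (S true (M + N ∷ w)))
    ≈⟨ Π-cong-⇔ (λ N → Σ-unpair) ⟩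
  QF (suc (suc j)) false (limitStep S false w)
    ∎
  where open ⇔-Reasoning

-- suc (k + n), computed by the recursion of iterLimit so that iterLimit's type reduces.
limitArity : ℕ → ℕ → ℕ
limitArity zero    n = suc n
limitArity (suc k) n = limitArity k (suc n)

limitArity-≡ : ∀ k n → limitArity k n ≡ suc (k + n)
limitArity-≡ zero    n = refl
limitArity-≡ (suc k) n = trans (limitArity-≡ k (suc n)) (cong suc (+-suc k n))

iterLimit : ∀ k {n} → Formula k (suc n) → Formula 0 (limitArity k n)
iterLimit zero    S = S
iterLimit (suc k) S = iterLimit k (limitStep S)

iterLimit-defines : ∀ k {n} {g : Vec ℕ k → Bool} {b c} {S : Formula k (suc n)} →
  IterLim k g b → Defines g c S → ∀ q → (b ≡ c) ⇔ QF (limitArity k n) q (iterLimit k S q [])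
iterLimit-defines zero    refl            g-def q = g-def q []
iterLimit-defines (suc k) (_ , lim , il) g-def   = iterLimit-defines k il (limitStep-defines lim g-def)

-- Matrices agreeing on the entries of small rank

module RankedAgreement (rank : Index → ℕ) where

  _≈[_]_ : Ω₁ → ℕ → Ω₁ → Set
  A ≈[ t ] B = ∀ f → rank f < t → eval f A ≡ eval f B

  ≈-refl : ∀ {t A} → A ≈[ t ] A
  ≈-refl _ _ = refl

  ≈-sym : ∀ {t A B} → A ≈[ t ] B → B ≈[ t ] A
  ≈-sym A≈B f lt = sym (A≈B f lt)

  ≈-trans : ∀ {t A B C} → A ≈[ t ] B → B ≈[ t ] C → A ≈[ t ] C
  ≈-trans A≈B B≈C f lt = trans (A≈B f lt) (B≈C f lt)

  ≈-weaken : ∀ {t t′ A B} → t ≤ t′ → A ≈[ t′ ] B → A ≈[ t ] B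
  ≈-weaken t≤t′ A≈B f lt = A≈B f (<-≤-trans lt t≤t′)

  module _ (𝒜 : GeneralAlgorithm) where
    open GeneralAlgorithm 𝒜

    Γ-stable : ∀ A → ∃[ t ] ∀ B → A ≈[ t ] B → Γ B ≡ Γ A
    Γ-stable A = suc bound , λ B A≈B → proj₁ (consistent A B λ f f∈Λ → sym (A≈B f (s≤s (read≤bound f∈Λ))))
      where
      bound : ℕ
      bound = max 0 (map rank (Λ A))

      read≤bound : ∀ {f} → f ∈ Λ A → rank f ≤ bound
      read≤bound = ListAll.lookup (map⁻ (xs≤max 0 (map rank (Λ A))))

    Γ≡⇔stable : ∀ A c → (Γ A ≡ c) ⇔ (∃[ t ] ∀ B → A ≈[ t ] B → Γ B ≡ c)
    Γ≡⇔stable A c = mk⇔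
      (λ ΓA≡c → let (t , stable) = Γ-stable A in t , λ B A≈B → trans (stable B A≈B) ΓA≡c)
      (λ (t , stable) → stable A ≈-refl)

    Γ≡⇔approached : ∀ A c → (Γ A ≡ c) ⇔ (∀ t → ∃[ B ] A ≈[ t ] B × Γ B ≡ c)
    Γ≡⇔approached A c = mk⇔
      (λ ΓA≡c t → A , ≈-refl , ΓA≡c)
      (λ near → let (t , stable) = Γ-stable A ; (B , A≈B , ΓB≡c) = near t
                in trans (sym (stable B A≈B)) ΓB≡c)

  Local : ∀ {k n} → (Ω₁ → Formula k n) → Set
  Local S = ∀ {A B} q w y → A ≈[ sum y ] B → S A q w y → S B q w y

  stabilityFormula : ∀ {k} → (Vec ℕ k → GeneralAlgorithm) → Bool → Ω₁ → Formula k 1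
  stabilityFormula algs c A true  w (t ∷ []) = ∀ B → A ≈[ t ] B → GeneralAlgorithm.Γ (algs w) B ≡ c
  stabilityFormula algs c A false w (t ∷ []) = ∃[ B ] A ≈[ t ] B × GeneralAlgorithm.Γ (algs w) B ≡ c

  stabilityFormula-defines : ∀ {k} (algs : Vec ℕ k → GeneralAlgorithm) c A →
    Defines (λ w → GeneralAlgorithm.Γ (algs w) A) c (stabilityFormula algs c A)
  stabilityFormula-defines algs c A true  w = Γ≡⇔stable (algs w) A c
  stabilityFormula-defines algs c A false w = Γ≡⇔approached (algs w) A c

  stabilityFormula-local : ∀ {k} (algs : Vec ℕ k → GeneralAlgorithm) c → Local (stabilityFormula algs c)
  stabilityFormula-local algs c true  w (t ∷ []) A≈A′ stable B A′≈B =
    stable B (≈-trans (≈-weaken (m≤m+n t 0) A≈A′) A′≈B)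
  stabilityFormula-local algs c false w (t ∷ []) A≈A′ (B , A≈B , ΓB≡c) =
    B , ≈-trans (≈-sym (≈-weaken (m≤m+n t 0) A≈A′)) A≈B , ΓB≡c

  limitStep-local : ∀ {k j} {S : Ω₁ → Formula (suc k) (suc j)} → Local S → Local (limitStep ∘ S)
  limitStep-local S-local q w (N ∷ p ∷ y) A≈B =
    S-local (not q) _ _ (≈-weaken (≤-trans (+-monoˡ-≤ (sum y) (proj₂-unpair-≤ p)) (m≤n+m _ N)) A≈B)

  iterLimit-local : ∀ k {n} {S : Ω₁ → Formula k (suc n)} → Local S → Local (iterLimit k ∘ S)
  iterLimit-local zero    S-local = S-local
  iterLimit-local (suc k) S-local = iterLimit-local k (limitStep-local S-local)

  fixedPoint : (r : Index → Ω₁ → Bool) → (∀ f {A B} → A ≈[ rank f ] B → r f A ≡ r f B) →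
               ∃[ A ] ∀ f → eval f A ≡ r f A
  fixedPoint r r-local = A* , λ f → r-local f (approx≈A* (rank f))
    where
    approx : ℕ → Ω₁
    approx zero    i j = false
    approx (suc s) i j = r (i , j) (approx s)

    approx-step : ∀ s → approx s ≈[ s ] approx (suc s)
    approx-step (suc s) f (s≤s rank≤s) = r-local f (≈-weaken rank≤s (approx-step s))

    approx-stable : ∀ {s s′} → s ≤′ s′ → approx s ≈[ s ] approx s′
    approx-stable (≤′-reflexive refl)        = ≈-refl
    approx-stable (≤′-step {n = s′} s≤′s′) =
      ≈-trans (approx-stable s≤′s′) (≈-weaken (≤′⇒≤ s≤′s′) (approx-step s′))

    A* : Ω₁
    A* i j = approx (suc (rank (i , j))) i j

    approx≈A* : ∀ s → approx s ≈[ s ] A*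
    approx≈A* s f rank<s = sym (approx-stable (≤⇒≤′ rank<s) f ≤-refl)

-- The two bounds, classically

module _ (em : ExcludedMiddle 0ℓ) where

  ⌊_⌋ : Set → Bool
  ⌊ P ⌋ = does (em {P})

  ⌊⌋≡true⇔ : {P : Set} → (⌊ P ⌋ ≡ true) ⇔ P
  ⌊⌋≡true⇔ {P} with em {P}
  ... | yes p  = mk⇔ (λ _ → p) (λ _ → refl)
  ... | no ¬p = mk⇔ (λ ()) (λ p → contradiction p ¬p)

  ⌊⌋-cong : {P Q : Set} → P ⇔ Q → ⌊ P ⌋ ≡ ⌊ Q ⌋
  ⌊⌋-cong P⇔Q = does-⇔ P⇔Q em em

  Bounded⟶Quant : ∀ q (P : ℕ → Set) → Converges (λ n → Bounded q n P) (Quant q P)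
  Bounded⟶Quant true P with em {∃ P}
  ... | yes (z , p) = z , λ n z≤n → mk⇔ (λ (z , _ , p) → z , p) (λ _ → z , z≤n , p)
  ... | no ¬∃P     = 0 , λ n _ → mk⇔ (λ (z , _ , p) → z , p) (λ ∃P → contradiction ∃P ¬∃P)
  Bounded⟶Quant false P with em {∃[ z ] ¬ P z}
  ... | yes (z , ¬p) = z , λ n z≤n → mk⇔ (λ h → contradiction (h z z≤n) ¬p) (λ h z _ → h z)
  ... | no ¬∃¬P     = 0 , λ n _ → mk⇔ (λ _ z → em⇒dne em (λ ¬p → ¬∃¬P (z , ¬p))) (λ h z _ → h z)

  boundedPrefix-iterLim : ∀ r q (P : Vec ℕ r → Set) →
                          IterLim r (λ v → ⌊ boundedPrefix r q P v ⌋) ⌊ QF r q P ⌋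
  boundedPrefix-iterLim zero    q P = refl
  boundedPrefix-iterLim (suc r) q P =
    (λ v → ⌊ boundedPrefix r q P′ v ⌋) ,
    (λ v → eventually-map (λ _ → ⌊⌋-cong)
                          (boundedPrefix-converges (λ x → Bounded⟶Quant _ (λ z → P (x ∷ʳ z))) v)) ,
    subst (IterLim r _) (⌊⌋-cong (⇔.sym (QF-∷ʳ r q P))) (boundedPrefix-iterLim r q P′)
    where
    P′ : Vec ℕ r → Set
    P′ x = Quant (alternate r q) (λ z → P (x ∷ʳ z))

  tower : ∀ m (β : Vec ℕ m ⤖ Index) → Tower m m β
  tower m β = record
    { alg       = alg
    ; converges = λ A → ⌊ XiHolds m β A ⌋ , boundedPrefix-iterLim m true (Entry A) , ⌊⌋≡true⇔
    }
    where
    open Inverse (⤖⇒↔ β) using () renaming (to to position)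

    Entry : Ω₁ → Vec ℕ m → Set
    Entry A x = eval (position x) A ≡ true

    alg : Vec ℕ m → GeneralAlgorithm
    alg v = record
      { Γ          = λ A → ⌊ boundedPrefix m true (Entry A) v ⌋
      ; Λ          = λ _ → map position (boundedVecs m (sum v))
      ; nonempty   = λ _ → position v , ∈-map⁺ position (∈-boundedVecs (xs≤sum v))
      ; consistent = λ A B B≈A →
          ⌊⌋-cong (boundedPrefix-cong (xs≤sum v) λ x x≤ →
                     subst-⇔ (_≡ true) (B≈A (position x) (∈-map⁺ position (∈-boundedVecs x≤)))) ,
          λ _ → ⇔.refl
      }

  module _ {m} (β : Vec ℕ m ⤖ Index) where
    open Inverse (⤖⇒↔ β) using (strictlyInverseʳ) renaming (to to position; from to coordinates)
    open RankedAgreement (sum ∘ coordinates)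

    diagonalMatrix : (Φ : Vec ℕ m → Ω₁ → Set) → (∀ u {A B} → A ≈[ sum u ] B → Φ u A → Φ u B) →
                     ∃[ A ] XiHolds m β A ⇔ QF m true (λ u → Φ u A)
    diagonalMatrix Φ Φ-local = A* , QF-cong diagonal
      where
      A*-fixed : ∃[ A ] ∀ f → eval f A ≡ ⌊ Φ (coordinates f) A ⌋
      A*-fixed = fixedPoint (λ f A → ⌊ Φ (coordinates f) A ⌋)
                            (λ f A≈B → ⌊⌋-cong (mk⇔ (Φ-local _ A≈B) (Φ-local _ (≈-sym A≈B))))

      A* : Ω₁
      A* = proj₁ A*-fixed

      diagonal : ∀ u → (eval (position u) A* ≡ true) ⇔ Φ u A*
      diagonal u = begin
        eval (position u) A* ≡ true                ≈⟨ subst-⇔ (_≡ true) (proj₂ A*-fixed (position u)) ⟩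
        ⌊ Φ (coordinates (position u)) A* ⌋ ≡ true ≈⟨ ⌊⌋≡true⇔ ⟩
        Φ (coordinates (position u)) A*            ≈⟨ subst-⇔ (λ u′ → Φ u′ A*) (strictlyInverseʳ u) ⟩
        Φ u A*                                     ∎
        where open ⇔-Reasoning

  no-tower-padded : ∀ d k (β : Vec ℕ (d + limitArity k 0) ⤖ Index) → ¬ Tower k (d + limitArity k 0) β
  no-tower-padded d k β T = ¬[b≡true⇔b≡false] (begin
    b ≡ true                               ≈⟨ Ξ[A*]≡b ⟩
    XiHolds (d + n) β A*                   ≈⟨ proj₂ A*-diagonal ⟩
    QF (d + n) true (λ u → Φ u A*)         ≈⟨ QF-drop d true _ ⟩
    QF n q (iterLimit k (formula A*) q []) ≈⟨ ⇔.sym (iterLimit-defines k lim[A*]≡b formula-defines q) ⟩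
    b ≡ false                              ∎)
    where
    open ⇔-Reasoning
    open RankedAgreement (sum ∘ Inverse.from (⤖⇒↔ β))

    n : ℕ
    n = limitArity k 0

    q : Bool
    q = alternate d true

    formula : Ω₁ → Formula k 1
    formula = stabilityFormula (Tower.alg T) false

    Φ : Vec ℕ (d + n) → Ω₁ → Set
    Φ u A = iterLimit k (formula A) q [] (drop d u)

    A*-diagonal : ∃[ A ] XiHolds (d + n) β A ⇔ QF (d + n) true (λ u → Φ u A)
    A*-diagonal = diagonalMatrix β Φ λ u A≈B →
      iterLimit-local k (stabilityFormula-local (Tower.alg T) false) q [] (drop d u)
                      (≈-weaken (sum-drop-≤ d u) A≈B)

    A* : Ω₁
    A* = proj₁ A*-diagonal

    formula-defines : Defines (λ w → GeneralAlgorithm.Γ (Tower.alg T w) A*) false (formula A*)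
    formula-defines = stabilityFormula-defines (Tower.alg T) false A*

    b : Bool
    b = proj₁ (Tower.converges T A*)

    lim[A*]≡b : IterLim k (λ w → GeneralAlgorithm.Γ (Tower.alg T w) A*) b
    lim[A*]≡b = proj₁ (proj₂ (Tower.converges T A*))

    Ξ[A*]≡b : XiValue (d + n) β A* b
    Ξ[A*]≡b = proj₂ (proj₂ (Tower.converges T A*))

  no-tower : ∀ {k m} → k < m → (β : Vec ℕ m ⤖ Index) → ¬ Tower k m β
  no-tower {k} {m} k<m =
    subst (λ m → (β : Vec ℕ m ⤖ Index) → ¬ Tower k m β) padding (no-tower-padded (m ∸ suc k) k)
    where
    padding : m ∸ suc k + limitArity k 0 ≡ m
    padding = trans (cong (m ∸ suc k +_) (trans (limitArity-≡ k 0) (cong suc (+-identityʳ k))))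
                    (m∸n+n≡m k<m)

theoremE7 : ExcludedMiddle 0ℓ → (m : ℕ) → 1 ≤ m → (β : Vec ℕ m ⤖ Index) →
    (¬ InDelta (m ∸ 1) m β) × (Tower m m β × (∀ k → k < m → ¬ Tower k m β))
theoremE7 em (suc m) _ β =
  (λ (k , k≤m , T) → no-tower em (s≤s k≤m) β T) ,
  tower em (suc m) β ,
  (λ k k<m → no-tower em k<m β)
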